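{- Let $G_1$ and $G_2$ be two connected graphs of orders $n_1$ and $n_2$, respectively, with $n_1>1$. Suppose $f$ is an automorphism of $G_1\star G_2$ such that the restriction of $f$ to $G_1$ is an automorphism of $G_1$, and $f$ maps copies of $G_2$ onto copies of $G_2$ (i.e. for each $i$ there is $k$ with $f(\{u^i_1,\dots,u^i_{n_2}\})=\{u^k_1,\dots,u^k_{n_2}\}$). Then there exist an automorphism $g$ of $G_1$ and automorphisms $h_1,\dots,h_{n_1}$ of $G_2$ such that for all $i\in\{1,\dots,n_1\}$ and $j\in\{1,\dots,n_2\}$, $f(u^i_j)=u^k_{j'}$, where $v_k=g(v_i)$ and $u_{j'}=h_i(u_j)$; that is, $f$ maps the $i$th copy $G_2^i$ of $G_2$ onto the $k$th copy, acting on it as $h_i$, with $v_k=g(v_i)$.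
   Context: All graphs are finite and simple. Let $V(G_1)=\{v_1,\dots,v_{n_1}\}$ and $V(G_2)=\{u_1,\dots,u_{n_2}\}$. The neighbourhood corona $G_1\star G_2$ is obtained by taking one copy of $G_1$ (vertices $v_1,\dots,v_{n_1}$) and $n_1$ copies of $G_2$, the $i$th copy $G_2^i$ having vertices $u^i_1,\dots,u^i_{n_2}$ ($u^i_j$ being the copy of $u_j$), and joining every neighbour (in $G_1$) of $v_i$ to every vertex of $G_2^i$, for each $i$. -}

module Defs where

open import Level using (0ℓ)
open import Data.Nat using (ℕ; _≤_)
open import Data.Fin using (Fin)
open import Data.Product using (Σ; _×_; _,_; ∃; proj₁)
open import Data.Sum using (_⊎_; inj₁; inj₂)
open import Data.Empty using (⊥)
open import Relation.Nullary using (¬_; Dec)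
open import Relation.Binary.PropositionalEquality using (_≡_)
open import Relation.Binary.Construct.Closure.ReflexiveTransitive using (Star)
open import Function.Bundles using (_↔_; _⇔_; Inverse)
open import Data.Fin using (_≟_)
open import Relation.Nullary.Decidable using (_×-dec_)

record Graph (V : Set) : Set₁ where
  field
    Adj    : V → V → Set
    adj?   : ∀ x y → Dec (Adj x y)
    sym    : ∀ {x y} → Adj x y → Adj y x
    irrefl : ∀ {x} → ¬ Adj x x
open Graph public

Connected : {V : Set} → Graph V → Set
Connected {V} G = V × (∀ x y → Star (Adj G) x y)

record Aut {V : Set} (G : Graph V) : Set where
  field
    perm     : V ↔ V
    preserve : ∀ x y → Adj G x y ⇔ Adj G (Inverse.to perm x) (Inverse.to perm y)
open Aut public

_⟨$⟩_ : {V : Set} {G : Graph V} → Aut G → V → V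
φ ⟨$⟩ x = Inverse.to (perm φ) x

-- Vertices of the neighbourhood corona G₁ ⋆ G₂:
--   inj₁ i       is v_i  (vertex of the copy of G₁)
--   inj₂ (i , j) is u^i_j (copy of u_j in the i-th copy G₂^i)
CVertex : ℕ → ℕ → Set
CVertex n₁ n₂ = Fin n₁ ⊎ (Fin n₁ × Fin n₂)

module _ {n₁ n₂ : ℕ} (G₁ : Graph (Fin n₁)) (G₂ : Graph (Fin n₂)) where

  CAdj : CVertex n₁ n₂ → CVertex n₁ n₂ → Set
  CAdj (inj₁ a) (inj₁ b) = Adj G₁ a b
  CAdj (inj₁ a) (inj₂ (i , j)) = Adj G₁ a i
  CAdj (inj₂ (i , j)) (inj₁ a) = Adj G₁ i a
  CAdj (inj₂ (i , j)) (inj₂ (k , l)) = (i ≡ k) × Adj G₂ j l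

  CAdj? : ∀ x y → Dec (CAdj x y)
  CAdj? (inj₁ a) (inj₁ b) = adj? G₁ a b
  CAdj? (inj₁ a) (inj₂ (i , j)) = adj? G₁ a i
  CAdj? (inj₂ (i , j)) (inj₁ a) = adj? G₁ i a
  CAdj? (inj₂ (i , j)) (inj₂ (k , l)) = (i ≟ k) ×-dec adj? G₂ j l

  CSym : ∀ {x y} → CAdj x y → CAdj y x
  CSym {inj₁ a} {inj₁ b} e = Graph.sym G₁ e
  CSym {inj₁ a} {inj₂ _} e = Graph.sym G₁ e
  CSym {inj₂ _} {inj₁ a} e = Graph.sym G₁ e
  CSym {inj₂ _} {inj₂ _} (p , e) = Relation.Binary.PropositionalEquality.sym p , Graph.sym G₂ e

  CIrrefl : ∀ {x} → ¬ CAdj x x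
  CIrrefl {inj₁ a} e = irrefl G₁ e
  CIrrefl {inj₂ _} (_ , e) = irrefl G₂ e

  _⋆_ : Graph (CVertex n₁ n₂)
  _⋆_ = record { Adj = CAdj ; adj? = CAdj? ; sym = λ {x} {y} → CSym {x} {y} ; irrefl = λ {x} → CIrrefl {x} }

-- Two vertices of one copy are adjacent exactly when their originals are adjacent in G₂,
-- so f restricted to the i-th copy is an automorphism h_i of G₂. The copy index i ↦ k(i)
-- is injective because f is, and surjective because f fixes G₁ setwise, so preimages of
-- copy vertices lie in copies. Since v_a ~ u^i_j holds exactly when a ~ i in G₁, f gives
-- a ~ i ⇔ σ(a) ~ k(i) for σ = f|G₁; taking a = σ⁻¹(k(i′)) turns this into
-- i ~ i′ ⇔ k(i) ~ k(i′).
module Submission where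

open import Defs
open import Level using (0ℓ)
open import Data.Nat using (ℕ; _>_)
open import Data.Fin using (Fin)
open import Data.Product using (Σ; ∃; _×_; _,_; proj₁; proj₂)
open import Data.Product.Properties using (,-injectiveˡ)
open import Data.Sum using (inj₁; inj₂)
open import Data.Sum.Properties using (inj₂-injective)
open import Function.Bundles using (_⇔_; Inverse; Injection; mk↔ₛ′; mk⇔; mk⤖)
open import Function.Definitions using (Injective)
open import Function.Consequences.Propositional using (strictlySurjective⇒surjective)
open import Function.Properties.Inverse using (↔⇒↣)
open import Function.Properties.Bijection using (⤖⇒↔)
open import Function.Properties.Equivalence using (⇔-setoid)
import Function.Properties.Equivalence as ⇔
open import Relation.Binary.PropositionalEquality as ≡ using (_≡_; refl; trans; cong)
import Relation.Binary.Reasoning.Setoid as SetoidReasoning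

module ⇔-Reasoning = SetoidReasoning (⇔-setoid 0ℓ)

module _ {V : Set} {G : Graph V} where

  Adj-cong : ∀ {x x′ y y′} → x ≡ x′ → y ≡ y′ → Adj G x y ⇔ Adj G x′ y′
  Adj-cong refl refl = ⇔.refl

  Adj-sym : ∀ x y → Adj G x y ⇔ Adj G y x
  Adj-sym x y = mk⇔ (Graph.sym G) (Graph.sym G)

  Adj-along : (φ : Aut G) → ∀ {x x′ y y′} → φ ⟨$⟩ x ≡ x′ → φ ⟨$⟩ y ≡ y′ →
              Adj G x y ⇔ Adj G x′ y′
  Adj-along φ {x} {y = y} e₁ e₂ = ⇔.trans (preserve φ x y) (Adj-cong e₁ e₂)

  ⟨$⟩-injective : (φ : Aut G) → Injective _≡_ _≡_ (φ ⟨$⟩_)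
  ⟨$⟩-injective φ = Injection.injective (↔⇒↣ (perm φ))

  preserves-Adj-if-intertwines :
    (σ : Aut G) (k : V → V) → (∀ a i → Adj G a i ⇔ Adj G (σ ⟨$⟩ a) (k i)) →
    ∀ i i′ → Adj G i i′ ⇔ Adj G (k i) (k i′)
  preserves-Adj-if-intertwines σ k intertwines i i′ = begin
    Adj G i i′                   ≈⟨ intertwines i i′ ⟩
    Adj G (σ ⟨$⟩ i) (k i′)       ≈⟨ Adj-sym _ _ ⟩
    Adj G (k i′) (σ ⟨$⟩ i)       ≈⟨ Adj-along σ σa≡ki′ refl ⟨
    Adj G a i                    ≈⟨ intertwines a i ⟩
    Adj G (σ ⟨$⟩ a) (k i)        ≈⟨ Adj-cong σa≡ki′ refl ⟩
    Adj G (k i′) (k i)           ≈⟨ Adj-sym _ _ ⟩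
    Adj G (k i) (k i′)           ∎
    where
    open ⇔-Reasoning
    a : V
    a = Inverse.from (perm σ) (k i′)
    σa≡ki′ : σ ⟨$⟩ a ≡ k i′
    σa≡ki′ = Inverse.strictlyInverseˡ (perm σ) (k i′)

module _ {n₁ n₂ : ℕ} {G₁ : Graph (Fin n₁)} {G₂ : Graph (Fin n₂)} (f : Aut (G₁ ⋆ G₂)) where

  MapsCopyOnto : Fin n₁ → Fin n₁ → Set
  MapsCopyOnto i k =
    (∀ j → ∃ λ j′ → f ⟨$⟩ inj₂ (i , j) ≡ inj₂ (k , j′)) ×
    (∀ j′ → ∃ λ j → f ⟨$⟩ inj₂ (i , j) ≡ inj₂ (k , j′))

  Adj-within-copy : ∀ i j l → Adj G₂ j l ⇔ Adj (G₁ ⋆ G₂) (inj₂ (i , j)) (inj₂ (i , l))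
  Adj-within-copy i j l = mk⇔ (refl ,_) proj₂

  copyAut : ∀ {i k} → MapsCopyOnto i k → Aut G₂
  copyAut {i} {k} (forth , back) = record
    { perm     = mk↔ₛ′ to from to∘from from∘to
    ; preserve = preserves
    }
    where
    open ⇔-Reasoning
    to from : Fin n₂ → Fin n₂
    to j = proj₁ (forth j)
    from j′ = proj₁ (back j′)

    to∘from : ∀ j′ → to (from j′) ≡ j′
    to∘from j′ = cong proj₂ (inj₂-injective
      (trans (≡.sym (proj₂ (forth (from j′)))) (proj₂ (back j′))))

    from∘to : ∀ j → from (to j) ≡ j
    from∘to j = cong proj₂ (inj₂-injective (⟨$⟩-injective f
      (trans (proj₂ (back (to j))) (≡.sym (proj₂ (forth j))))))

    preserves : ∀ j l → Adj G₂ j l ⇔ Adj G₂ (to j) (to l)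
    preserves j l = begin
      Adj G₂ j l
        ≈⟨ Adj-within-copy i j l ⟩
      Adj (G₁ ⋆ G₂) (inj₂ (i , j)) (inj₂ (i , l))
        ≈⟨ Adj-along f (proj₂ (forth j)) (proj₂ (forth l)) ⟩
      Adj (G₁ ⋆ G₂) (inj₂ (k , to j)) (inj₂ (k , to l))
        ≈⟨ Adj-within-copy k (to j) (to l) ⟨
      Adj G₂ (to j) (to l)
        ∎

  copyAut-correct : ∀ {i k} (m : MapsCopyOnto i k) j →
                    f ⟨$⟩ inj₂ (i , j) ≡ inj₂ (k , copyAut m ⟨$⟩ j)
  copyAut-correct (forth , _) j = proj₂ (forth j)

  module _ (copies : ∀ i → ∃ (MapsCopyOnto i)) where

    copyIndex : Fin n₁ → Fin n₁
    copyIndex i = proj₁ (copies i)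

    copyAt : Fin n₁ → Aut G₂
    copyAt i = copyAut (proj₂ (copies i))

    copyAt-correct : ∀ i j → f ⟨$⟩ inj₂ (i , j) ≡ inj₂ (copyIndex i , copyAt i ⟨$⟩ j)
    copyAt-correct i = copyAut-correct (proj₂ (copies i))

    copyIndex-injective : Fin n₂ → Injective _≡_ _≡_ copyIndex
    copyIndex-injective j₀ {i} {i′} k≡k′ = ,-injectiveˡ (inj₂-injective (⟨$⟩-injective f (begin
      f ⟨$⟩ inj₂ (i , j₀)             ≡⟨ copyAt-correct i j₀ ⟩
      inj₂ (copyIndex i , j′)         ≡⟨ cong (λ k → inj₂ (k , j′)) k≡k′ ⟩
      inj₂ (copyIndex i′ , j′)        ≡⟨ proj₂ preimage ⟨
      f ⟨$⟩ inj₂ (i′ , proj₁ preimage) ∎)))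
      where
      open ≡.≡-Reasoning
      j′ : Fin n₂
      j′ = copyAt i ⟨$⟩ j₀
      preimage : ∃ λ j → f ⟨$⟩ inj₂ (i′ , j) ≡ inj₂ (copyIndex i′ , j′)
      preimage = proj₂ (proj₂ (copies i′)) j′

    copyIndex-surjective : Fin n₂ → (∀ a → ∃ λ b → f ⟨$⟩ inj₁ a ≡ inj₁ b) →
                           ∀ k → ∃ λ i → copyIndex i ≡ k
    copyIndex-surjective j₀ fixes-G₁ k =
      preimage (Inverse.from (perm f) (inj₂ (k , j₀))) (Inverse.strictlyInverseˡ (perm f) _)
      where
      preimage : ∀ x → f ⟨$⟩ x ≡ inj₂ (k , j₀) → ∃ λ i → copyIndex i ≡ k
      preimage (inj₁ a) e with () ← trans (≡.sym (proj₂ (fixes-G₁ a))) e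
      preimage (inj₂ (i , j)) e =
        i , ,-injectiveˡ (inj₂-injective (trans (≡.sym (copyAt-correct i j)) e))

    copyIndexAut : Fin n₂ → (σ : Aut G₁) → (∀ a → f ⟨$⟩ inj₁ a ≡ inj₁ (σ ⟨$⟩ a)) → Aut G₁
    copyIndexAut j₀ σ f-on-G₁ = record
      { perm     = ⤖⇒↔ (mk⤖ (copyIndex-injective j₀ , strictlySurjective⇒surjective
                     (copyIndex-surjective j₀ (λ a → σ ⟨$⟩ a , f-on-G₁ a))))
      ; preserve = preserves-Adj-if-intertwines σ copyIndex intertwines
      }
      where
      intertwines : ∀ a i → Adj G₁ a i ⇔ Adj G₁ (σ ⟨$⟩ a) (copyIndex i)
      intertwines a i = Adj-along f (f-on-G₁ a) (copyAt-correct i j₀)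

-- Connectedness of G₂ is used only for a vertex j₀ of G₂.
lemma2p3 : {n₁ n₂ : ℕ} (G₁ : Graph (Fin n₁)) (G₂ : Graph (Fin n₂)) →
    Connected G₁ → Connected G₂ → n₁ > 1 →
    (f : Aut (G₁ ⋆ G₂)) →
    (Σ (Aut G₁) λ σ → ∀ a → f ⟨$⟩ inj₁ a ≡ inj₁ (σ ⟨$⟩ a)) →
    (∀ i → ∃ λ k →
    (∀ j → ∃ λ j′ → f ⟨$⟩ inj₂ (i , j) ≡ inj₂ (k , j′)) ×
    (∀ j′ → ∃ λ j → f ⟨$⟩ inj₂ (i , j) ≡ inj₂ (k , j′))) →
    Σ (Aut G₁) λ g → Σ (Fin n₁ → Aut G₂) λ h →
    ∀ i j → f ⟨$⟩ inj₂ (i , j) ≡ inj₂ (g ⟨$⟩ i , h i ⟨$⟩ j)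
lemma2p3 G₁ G₂ _ (j₀ , _) _ f (σ , f-on-G₁) copies =
  copyIndexAut f copies j₀ σ f-on-G₁ , copyAt f copies , copyAt-correct f copies
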